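{- Let $a$ and $b$ be positive integers. Then there exists a connected graph $G$ such that $trc(G)=a$ and $strc(G)=b$ if and only if $a=b\in\{1,3,4\}$ or $5\le a\le b$.
   Context: All graphs are finite and simple. In a total-coloured graph (vertices and edges coloured), a path is total-rainbow if its edges and internal vertices all have pairwise distinct colours. A total-colouring of a connected graph $G$ is total rainbow connected if any two vertices are joined by a total-rainbow path, and strongly total rainbow connected if any two vertices $u,v$ are joined by a total-rainbow $u$–$v$ geodesic (a $u$–$v$ path of length $d(u,v)$). The total rainbow connection number $trc(G)$ (resp. strong total rainbow connection number $strc(G)$) is the minimum number of colours in a total rainbow connected (resp. strongly total rainbow connected) total-colouring of $G$. -}

module Defs where

open import Data.Nat using (ℕ; zero; suc; _<_; _≤_)
open import Data.Fin using (Fin; zero; suc; toℕ; fromℕ; inject₁)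
open import Data.Bool using (Bool; true; false)
open import Data.Product using (Σ; ∃; _×_; _,_)
open import Relation.Binary.PropositionalEquality using (_≡_; _≢_)
open import Relation.Nullary using (¬_)
open import Function.Definitions using (Injective)

record Graph : Set where
  field
    n       : ℕ
    adj     : Fin n → Fin n → Bool
    adj-sym : ∀ u v → adj u v ≡ adj v u
    adj-irr : ∀ v → adj v v ≡ false

module _ (G : Graph) where
  open Graph G

  V : Set
  V = Fin n

  record Path (u v : V) (ℓ : ℕ) : Set where
    field
      p        : Fin (suc ℓ) → V
      start    : p zero ≡ u
      end      : p (fromℕ ℓ) ≡ v
      adjacent : ∀ (i : Fin ℓ) → adj (p (inject₁ i)) (p (suc i)) ≡ true
      distinct : Injective _≡_ _≡_ p

  Connected : Set
  Connected = ∀ u v → Σ ℕ λ ℓ → Path u v ℓ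

  IsGeodesic : ∀ {u v ℓ} → Path u v ℓ → Set
  IsGeodesic {u} {v} {ℓ} _ = ∀ m → Path u v m → ℓ ≤ m

  -- A total-colouring of G with colour set Fin k (vertices and edges coloured;
  -- the edge colour is symmetric so each edge uv has a single colour).
  record TotalColouring (k : ℕ) : Set where
    field
      vcol     : V → Fin k
      ecol     : V → V → Fin k
      ecol-sym : ∀ u v → ecol u v ≡ ecol v u

  module _ {k : ℕ} (c : TotalColouring k) where
    open TotalColouring c

    Internal : (ℓ : ℕ) → Fin (suc ℓ) → Set
    Internal ℓ i = 0 < toℕ i × toℕ i < ℓ

    TotalRainbow : ∀ {u v ℓ} → Path u v ℓ → Set
    TotalRainbow {ℓ = ℓ} P =
        (∀ (i j : Fin ℓ) → ecol (p (inject₁ i)) (p (suc i)) ≡ ecol (p (inject₁ j)) (p (suc j)) → i ≡ j)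
      × (∀ (i j : Fin (suc ℓ)) → Internal ℓ i → Internal ℓ j → vcol (p i) ≡ vcol (p j) → i ≡ j)
      × (∀ (i : Fin ℓ) (j : Fin (suc ℓ)) → Internal ℓ j → ecol (p (inject₁ i)) (p (suc i)) ≢ vcol (p j))
      where open Path P

    TotalRainbowConnected : Set
    TotalRainbowConnected = ∀ u v → Σ ℕ λ ℓ → Σ (Path u v ℓ) TotalRainbow

    StronglyTotalRainbowConnected : Set
    StronglyTotalRainbowConnected =
      ∀ u v → Σ ℕ λ ℓ → Σ (Path u v ℓ) λ P → IsGeodesic P × TotalRainbow P

  -- Some total-colouring with at most k colours (colour set Fin k) works.
  HasTRC : ℕ → Set
  HasTRC k = Σ (TotalColouring k) TotalRainbowConnected

  HasSTRC : ℕ → Set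
  HasSTRC k = Σ (TotalColouring k) StronglyTotalRainbowConnected

  trc≡ : ℕ → Set
  trc≡ a = HasTRC a × (∀ m → m < a → ¬ HasTRC m)

  strc≡ : ℕ → Set
  strc≡ b = HasSTRC b × (∀ m → m < b → ¬ HasSTRC m)

-- A total-rainbow path of length ℓ shows its ℓ edges and ℓ − 1 internal vertices in distinct colours,
-- so it needs 2ℓ − 1 colours. With two colours every rainbow path is therefore a single edge and one
-- colour already suffices, so trc ≠ 2. With at most four colours rainbow paths have length at most 2,
-- and such a path is either a geodesic or can be replaced by an edge, so trc ≤ 4 forces strc = trc.
-- Together with trc ≤ strc only the listed pairs remain.
-- All of them occur for windmills, a centre carrying k pendant leaves and g triangles. Two leaves
-- are joined only through the centre, which forces k + 1 colours for trc; two of the k + g spokes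
-- (the leaves and one tip of each triangle) have the centre as their only common neighbour, which
-- forces k + g + 1 colours for strc. Both bounds are attained, the first one when k ≥ 4; the cases
-- a = b ∈ {3, 4} are the stars with k = 2, 3 and g = 0, and a = b = 1 is the single vertex.

{-# OPTIONS --safe #-}
module Submission where

open import Defs
open import Data.Bool using (Bool; true; false; _∨_)
open import Data.Bool.Properties using (∨-comm; ∨-identityʳ)
open import Data.Empty using (⊥-elim)
open import Data.Fin.Patterns using (0F; 1F; 2F; 3F; 4F)
open import Data.Fin using (Fin; zero; suc; fromℕ; inject₁; lower₁; splitAt; join)
open import Data.Fin.Properties using (_≟_; 1↔⊤; 0≢1+n; suc-injective; inject₁-injective; inject₁-lower₁; toℕ-inject₁; toℕ<n; injective⇒≤; +↔⊎; splitAt-join)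
open import Data.Nat using (ℕ; zero; suc; pred; _+_; _≤_; _<_; z≤n; s≤s; _≤?_)
open import Data.Nat.Properties using (m≤m+n; ≤-antisym; ≮⇒≥; m≤n⇒∃[o]m+o≡n; ≤-refl; ≤-trans; ≤⇒≯; ≰⇒>; >⇒≢; +-mono-≤; pred-mono-≤)
open import Data.Product using (Σ; ∃; _×_; _,_; proj₁; proj₂)
open import Data.Sum using (_⊎_; inj₁; inj₂)
open import Data.Sum.Properties using (inj₁-injective; inj₂-injective; ≡-dec)
open import Data.Sum.Function.Propositional using (_⊎-↔_)
open import Data.Unit using (⊤; tt)
import Data.Unit.Properties as Unit
open import Data.Vec using (Vec; []; _∷_; lookup; tabulate)
open import Data.Vec.Properties using (lookup∘tabulate)
open import Data.Vec.Relation.Unary.All using ([]; _∷_)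
open import Data.Vec.Relation.Unary.AllPairs using ([]; _∷_; allPairs?)
open import Data.Vec.Relation.Unary.Unique.Propositional using (Unique)
open import Data.Vec.Relation.Unary.Unique.Propositional.Properties using (lookup-injective)
open import Function using (_∘_)
open import Function.Bundles using (Injection; Inverse; _↔_; _⇔_; mk⇔)
open import Function.Definitions using (Injective)
open import Function.Properties.Inverse using (↔⇒↣; ↔-sym; ↔-refl; ↔-trans)
open import Relation.Binary.PropositionalEquality using (_≡_; _≢_; refl; sym; trans; cong; cong₂; subst; subst₂)
open import Relation.Binary.Definitions using (DecidableEquality)
open import Relation.Nullary using (¬_; Dec; yes; no; does; ¬?; contradiction)
open import Relation.Nullary.Decidable using (True; toWitness; dec-true)

inner : ∀ {ℓ} → Fin (pred ℓ) → Fin (suc ℓ)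
inner {suc _} j = suc (inject₁ j)

inner-injective : ∀ {ℓ} {i j : Fin (pred ℓ)} → inner {ℓ} i ≡ inner j → i ≡ j
inner-injective {suc _} e = inject₁-injective (suc-injective e)

another : ∀ {m} → 2 ≤ m → (i : Fin m) → ∃ λ j → i ≢ j
another (s≤s (s≤s _)) zero    = suc zero , λ ()
another (s≤s (s≤s _)) (suc _) = zero , λ ()

splitAt-injective : ∀ m {n} → Injective _≡_ _≡_ (splitAt m {n})
splitAt-injective m = Injection.injective (↔⇒↣ (+↔⊎ {m}))

join-injective : ∀ m n → Injective _≡_ _≡_ (join m n)
join-injective m n = Injection.injective (↔⇒↣ (↔-sym (+↔⊎ {m} {n})))

module _ {B : Set} (_≟ᴮ_ : DecidableEquality B) where

  unique? : ∀ {n} (xs : Vec B n) → Dec (Unique xs)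
  unique? = allPairs? (λ x y → ¬? (x ≟ᴮ y))

  -- Whenever `unique? xs` evaluates to `yes` (e.g. on concrete vectors), Agda fills in the implicit proof.
  unique-by-decision : ∀ {n} {xs : Vec B n} {_ : True (unique? xs)} → Unique xs
  unique-by-decision {_} {_} {ok} = toWitness ok

dec-true⁻¹ : ∀ {P : Set} (p? : Dec P) → does p? ≡ true → P
dec-true⁻¹ (yes p) _ = p

-- Paths and geodesics

module _ (G : Graph) where
  open Graph G

  pathAlong : ∀ {ℓ} (vs : Vec (V G) (suc ℓ)) → Unique vs
            → (∀ i → adj (lookup vs (inject₁ i)) (lookup vs (suc i)) ≡ true)
            → Path G (lookup vs zero) (lookup vs (fromℕ ℓ)) ℓ
  pathAlong vs distinct adjacent = record
    { p = lookup vs ; start = refl ; end = refl ; adjacent = adjacent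
    ; distinct = lookup-injective distinct _ _ }

  trivialPath : ∀ u → Path G u u 0
  trivialPath u = pathAlong (u ∷ []) ([] ∷ []) λ ()

  edgePath : ∀ {u v} → u ≢ v → adj u v ≡ true → Path G u v 1
  edgePath u≢v uv = pathAlong (_ ∷ _ ∷ []) ((u≢v ∷ []) ∷ [] ∷ []) λ { zero → uv }

  length0⇒ends-equal : ∀ {u v} → Path G u v 0 → u ≡ v
  length0⇒ends-equal P = trans (sym start) end where open Path P

  length1⇒ends-adjacent : ∀ {u v} → Path G u v 1 → adj u v ≡ true
  length1⇒ends-adjacent P = subst₂ (λ x y → adj x y ≡ true) start end (adjacent zero) where open Path P

  ends-distinct : ∀ {u v ℓ} → Path G u v (suc ℓ) → u ≢ v
  ends-distinct P u≡v = 0≢1+n (distinct (trans start (trans u≡v (sym end))))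
    where open Path P

  second-adjacent : ∀ {u v ℓ} (P : Path G u v (suc ℓ)) → adj u (Path.p P (suc zero)) ≡ true
  second-adjacent P = subst (λ x → adj x (p (suc zero)) ≡ true) start (adjacent zero)
    where open Path P

  penultimate-adjacent : ∀ {u v ℓ} (P : Path G u v (suc ℓ)) → adj (Path.p P (inject₁ (fromℕ ℓ))) v ≡ true
  penultimate-adjacent {ℓ = ℓ} P = subst (λ y → adj (p (inject₁ (fromℕ ℓ))) y ≡ true) end (adjacent (fromℕ ℓ))
    where open Path P

  length0-geodesic : ∀ {u v} (P : Path G u v 0) → IsGeodesic G P
  length0-geodesic _ _ _ = z≤n

  length1-geodesic : ∀ {u v} (P : Path G u v 1) → IsGeodesic G P
  length1-geodesic P zero    Q = ⊥-elim (ends-distinct P (length0⇒ends-equal Q))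
  length1-geodesic P (suc _) _ = s≤s z≤n

  nonadjacent-length2-geodesic : ∀ {u v} → adj u v ≡ false → (P : Path G u v 2) → IsGeodesic G P
  nonadjacent-length2-geodesic _      P zero          Q = ⊥-elim (ends-distinct P (length0⇒ends-equal Q))
  nonadjacent-length2-geodesic u≁v    _ (suc zero)    Q = contradiction (trans (sym (length1⇒ends-adjacent Q)) u≁v) λ ()
  nonadjacent-length2-geodesic _      _ (suc (suc _)) _ = s≤s (s≤s z≤n)

  -- Colours along a path

  module _ {k : ℕ} (c : TotalColouring G k) where
    open TotalColouring c

    inner-internal : ∀ {ℓ} (j : Fin (pred ℓ)) → Internal G c ℓ (inner j)
    inner-internal {suc ℓ} j = s≤s z≤n , s≤s (subst (_< ℓ) (sym (toℕ-inject₁ j)) (toℕ<n j))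

    internal⇒inner : ∀ {ℓ} {i : Fin (suc ℓ)} → Internal G c ℓ i → ∃ λ j → inner j ≡ i
    internal⇒inner {zero}  (_ , ())
    internal⇒inner {suc ℓ} {zero}  (() , _)
    internal⇒inner {suc ℓ} {suc i} (_ , s≤s i<ℓ) = lower₁ i (>⇒≢ i<ℓ) , cong suc (inject₁-lower₁ i (>⇒≢ i<ℓ))

    pathColours : ∀ {u v ℓ} → Path G u v ℓ → Fin ℓ ⊎ Fin (pred ℓ) → Fin k
    pathColours P (inj₁ i) = ecol (Path.p P (inject₁ i)) (Path.p P (suc i))
    pathColours P (inj₂ j) = vcol (Path.p P (inner j))

    rainbow⇒pathColours-injective : ∀ {u v ℓ} (P : Path G u v ℓ) → TotalRainbow G c P
                                 → Injective _≡_ _≡_ (pathColours P)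
    rainbow⇒pathColours-injective P (edges , vertices , mixed) = injective
      where
        injective : Injective _≡_ _≡_ (pathColours P)
        injective {inj₁ i} {inj₁ j} e = cong inj₁ (edges i j e)
        injective {inj₁ i} {inj₂ b} e = ⊥-elim (mixed i (inner b) (inner-internal b) e)
        injective {inj₂ a} {inj₁ j} e = ⊥-elim (mixed j (inner a) (inner-internal a) (sym e))
        injective {inj₂ a} {inj₂ b} e =
          cong inj₂ (inner-injective (vertices _ _ (inner-internal a) (inner-internal b) e))

    pathColours-injective⇒rainbow : ∀ {u v ℓ} (P : Path G u v ℓ)
                                 → Injective _≡_ _≡_ (pathColours P) → TotalRainbow G c P
    pathColours-injective⇒rainbow {ℓ = ℓ} P injective =
      (λ i j e → inj₁-injective (injective e)) , vertices , mixed
      where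
        open Path P
        vertices : ∀ i j → Internal G c ℓ i → Internal G c ℓ j → vcol (p i) ≡ vcol (p j) → i ≡ j
        vertices i j i-internal j-internal e with internal⇒inner i-internal | internal⇒inner j-internal
        ... | a , refl | b , refl = cong inner (inj₂-injective (injective {inj₂ a} {inj₂ b} e))
        mixed : ∀ i j → Internal G c ℓ j → ecol (p (inject₁ i)) (p (suc i)) ≢ vcol (p j)
        mixed i j j-internal e with internal⇒inner j-internal
        ... | b , refl = contradiction (injective {inj₁ i} {inj₂ b} e) λ ()

    rainbow-colour-bound : ∀ {u v ℓ n} (P : Path G u v ℓ) → n ≤ ℓ → TotalRainbow G c P → n + pred n ≤ k
    rainbow-colour-bound {ℓ = ℓ} P n≤ℓ rainbow =
      ≤-trans (+-mono-≤ n≤ℓ (pred-mono-≤ n≤ℓ))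
              (injective⇒≤ (splitAt-injective ℓ ∘ rainbow⇒pathColours-injective P rainbow))

    short-path-rainbow : ∀ {u v ℓ} → ℓ ≤ 1 → (P : Path G u v ℓ) → TotalRainbow G c P
    short-path-rainbow ℓ≤1 P = pathColours-injective⇒rainbow P (λ {x} {y} _ → at-most-one ℓ≤1 x y)
      where
        at-most-one : ∀ {ℓ} → ℓ ≤ 1 → (x y : Fin ℓ ⊎ Fin (pred ℓ)) → x ≡ y
        at-most-one z≤n       (inj₁ ())   _
        at-most-one z≤n       (inj₂ ())   _
        at-most-one (s≤s z≤n) (inj₁ zero) (inj₁ zero) = refl

    record RainbowWedge (u z v : V G) : Set where
      field
        edges-distinct : ecol u z ≢ ecol z v
        first≢centre   : ecol u z ≢ vcol z
        second≢centre  : ecol z v ≢ vcol z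

    wedge-rainbow : ∀ {u z v} (P : Path G u v 2) → Path.p P (suc zero) ≡ z → TotalRainbow G c P
                  → RainbowWedge u z v
    wedge-rainbow record { start = refl ; end = refl } refl (edges , _ , mixed) = record
      { edges-distinct = λ e → 0≢1+n (edges zero (suc zero) e)
      ; first≢centre   = mixed zero (suc zero) centre
      ; second≢centre  = mixed (suc zero) (suc zero) centre
      }
      where
        centre : Internal G c 2 (suc zero)
        centre = s≤s z≤n , s≤s (s≤s z≤n)

    pendants-wedge : ∀ {u v z ℓ} → u ≢ v
                   → (∀ w → adj u w ≡ true → w ≡ z) → (∀ w → adj v w ≡ true → w ≡ z)
                   → (P : Path G u v ℓ) → TotalRainbow G c P → RainbowWedge u z v
    pendants-wedge {ℓ = zero} u≢v _ _ P _ = ⊥-elim (u≢v (length0⇒ends-equal P))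
    pendants-wedge {u} {v} {ℓ = suc zero} u≢v at-u at-v P _ =
      ⊥-elim (u≢v (trans (at-v u (trans (adj-sym v u) uv)) (sym (at-u v uv))))
      where
        uv : adj u v ≡ true
        uv = length1⇒ends-adjacent P
    pendants-wedge {ℓ = suc (suc zero)} _ at-u _ P rainbow =
      wedge-rainbow P (at-u _ (second-adjacent P)) rainbow
    pendants-wedge {v = v} {z} {ℓ = suc (suc (suc m))} _ at-u at-v P _ =
      ⊥-elim (0≢1+n (suc-injective (distinct (trans second≡z (sym penultimate≡z)))))
      where
        open Path P
        second≡z : p (suc zero) ≡ z
        second≡z = at-u _ (second-adjacent P)
        penultimate≡z : p (inject₁ (fromℕ (suc (suc m)))) ≡ z
        penultimate≡z = at-v _ (trans (adj-sym v _) (penultimate-adjacent P))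

    geodesic-wedge : ∀ {u v z ℓ} → adj u v ≡ false → Path G u v 2
                   → (∀ w → adj u w ≡ true → adj w v ≡ true → w ≡ z)
                   → (P : Path G u v ℓ) → IsGeodesic G P → TotalRainbow G c P → RainbowWedge u z v
    geodesic-wedge {ℓ = zero} _ Q _ P _ _ = ⊥-elim (ends-distinct Q (length0⇒ends-equal P))
    geodesic-wedge {ℓ = suc zero} u≁v _ _ P _ _ =
      contradiction (trans (sym (length1⇒ends-adjacent P)) u≁v) λ ()
    geodesic-wedge {ℓ = suc (suc zero)} _ _ common P _ rainbow =
      wedge-rainbow P (common _ (second-adjacent P) (penultimate-adjacent P)) rainbow
    geodesic-wedge {ℓ = suc (suc (suc _))} _ Q _ _ geodesic _ with geodesic 2 Q
    ... | s≤s (s≤s ())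

    wedges-star-bound : ∀ {m z} (leaf : Fin m → V G) → 2 ≤ m
                      → (∀ i j → i ≢ j → RainbowWedge (leaf i) z (leaf j)) → suc m ≤ k
    wedges-star-bound {m} {z} leaf 2≤m wedge = injective⇒≤ injective
      where
        open RainbowWedge
        colour : Fin (suc m) → Fin k
        colour zero    = vcol z
        colour (suc i) = ecol (leaf i) z
        centre≢ray : ∀ i → vcol z ≢ ecol (leaf i) z
        centre≢ray i e = first≢centre (wedge i _ (proj₂ (another 2≤m i))) (sym e)
        injective : Injective _≡_ _≡_ colour
        injective {zero}  {zero}  _ = refl
        injective {zero}  {suc j} e = ⊥-elim (centre≢ray j e)
        injective {suc i} {zero}  e = ⊥-elim (centre≢ray i (sym e))
        injective {suc i} {suc j} e with i ≟ j
        ... | yes i≡j = cong suc i≡j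
        ... | no  i≢j = ⊥-elim (edges-distinct (wedge i j i≢j) (trans e (ecol-sym _ _)))

  strongly⇒rainbow : ∀ {k} → HasSTRC G k → HasTRC G k
  strongly⇒rainbow (c , strong) = c , λ u v → let ℓ , P , _ , rainbow = strong u v in ℓ , P , rainbow

  strongly⇒connected : ∀ {k} → HasSTRC G k → Connected G
  strongly⇒connected (_ , strong) u v = let ℓ , P , _ = strong u v in ℓ , P

  no-colouring-without-colours : V G → ¬ TotalColouring G 0
  no-colouring-without-colours v c with TotalColouring.vcol c v
  ... | ()

  few-colours-rainbow⇒strongly : ∀ {k} (c : TotalColouring G k) → k ≤ 4
                               → TotalRainbowConnected G c → StronglyTotalRainbowConnected G c
  few-colours-rainbow⇒strongly c k≤4 connected u v = shortcut (connected u v)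
    where
      shortcut : Σ ℕ (λ ℓ → Σ (Path G u v ℓ) (TotalRainbow G c))
               → Σ ℕ λ ℓ → Σ (Path G u v ℓ) λ P → IsGeodesic G P × TotalRainbow G c P
      shortcut (0 , P , rainbow) = 0 , P , length0-geodesic P , rainbow
      shortcut (1 , P , rainbow) = 1 , P , length1-geodesic P , rainbow
      shortcut (2 , P , rainbow) with adj u v in uv
      ... | true  = 1 , edge , length1-geodesic edge , short-path-rainbow c ≤-refl edge
        where
          edge : Path G u v 1
          edge = edgePath (ends-distinct P) uv
      ... | false = 2 , P , nonadjacent-length2-geodesic uv P , rainbow
      shortcut (suc (suc (suc _)) , P , rainbow) =
        contradiction (rainbow-colour-bound c P (s≤s (s≤s (s≤s z≤n))) rainbow) (≤⇒≯ k≤4)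

  two-colours⇒one : HasTRC G 2 → HasTRC G 1
  two-colours⇒one (c , connected) = monochrome , λ u v → recolour (connected u v)
    where
      monochrome : TotalColouring G 1
      monochrome = record { vcol = λ _ → zero ; ecol = λ _ _ → zero ; ecol-sym = λ _ _ → refl }
      recolour : ∀ {u v} → Σ ℕ (λ ℓ → Σ (Path G u v ℓ) (TotalRainbow G c))
               → Σ ℕ (λ ℓ → Σ (Path G u v ℓ) (TotalRainbow G monochrome))
      recolour (ℓ , P , rainbow) with ℓ ≤? 1
      ... | yes ℓ≤1 = ℓ , P , short-path-rainbow monochrome ℓ≤1 P
      ... | no  ℓ≰1 = contradiction (rainbow-colour-bound c P (≰⇒> ℓ≰1) rainbow) λ { (s≤s (s≤s ())) }

-- Graphs with named vertices

module NamedGraph {A : Set} {N : ℕ} (naming : Fin N ↔ A) (E : A → A → Bool)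
                 (E-sym : ∀ a b → E a b ≡ E b a) (E-irr : ∀ a → E a a ≡ false) where
  open Inverse naming public using (to; from)
  open Inverse naming using (strictlyInverseˡ; strictlyInverseʳ)

  graph : Graph
  graph = record
    { n = N ; adj = λ u v → E (to u) (to v)
    ; adj-sym = λ u v → E-sym (to u) (to v) ; adj-irr = λ u → E-irr (to u) }

  open Graph graph using (adj)

  from-injective : ∀ {a b} → from a ≡ from b → a ≡ b
  from-injective {a} {b} e = trans (sym (strictlyInverseˡ a)) (trans (cong to e) (strictlyInverseˡ b))

  named : ∀ {w a} → to w ≡ a → w ≡ from a
  named {w} e = trans (sym (strictlyInverseʳ w)) (cong from e)

  adj-from : ∀ a b → adj (from a) (from b) ≡ E a b
  adj-from a b = cong₂ E (strictlyInverseˡ a) (strictlyInverseˡ b)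

  adj-fromˡ : ∀ a w → adj (from a) w ≡ E a (to w)
  adj-fromˡ a w = cong (λ x → E x (to w)) (strictlyInverseˡ a)

  adj-fromʳ : ∀ w a → adj w (from a) ≡ E (to w) a
  adj-fromʳ w a = cong (E (to w)) (strictlyInverseˡ a)

  for-all-names : (R : V graph → V graph → Set) → (∀ a b → R (from a) (from b)) → ∀ u v → R u v
  for-all-names R r u v = subst₂ R (strictlyInverseʳ u) (strictlyInverseʳ v) (r (to u) (to v))

  sole-neighbour : ∀ {a b} → (∀ t → E a t ≡ true → t ≡ b)
                 → ∀ w → adj (from a) w ≡ true → w ≡ from b
  sole-neighbour {a} only-b w aw = named (only-b (to w) (trans (sym (adj-fromˡ a w)) aw))

  sole-common-neighbour : ∀ {a b c} → (∀ t → E a t ≡ true → E t c ≡ true → t ≡ b)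
                        → ∀ w → adj (from a) w ≡ true → adj w (from c) ≡ true → w ≡ from b
  sole-common-neighbour {a} {c = c} only-b w aw wc =
    named (only-b (to w) (trans (sym (adj-fromˡ a w)) aw) (trans (sym (adj-fromʳ w c)) wc))

  namedPath : ∀ {ℓ} (ts : Vec A (suc ℓ)) → Unique ts
            → (∀ i → E (lookup ts (inject₁ i)) (lookup ts (suc i)) ≡ true)
            → Path graph (from (lookup ts zero)) (from (lookup ts (fromℕ ℓ))) ℓ
  namedPath ts distinct adjacent = record
    { p = from ∘ lookup ts ; start = refl ; end = refl
    ; adjacent = λ i → trans (adj-from _ _) (adjacent i)
    ; distinct = lookup-injective distinct _ _ ∘ from-injective }

  module Coloured {k} (vA : A → Fin k) (eA : A → A → Fin k) (eA-sym : ∀ a b → eA a b ≡ eA b a) where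

    colouring : TotalColouring graph k
    colouring = record
      { vcol = vA ∘ to ; ecol = λ u v → eA (to u) (to v) ; ecol-sym = λ u v → eA-sym (to u) (to v) }

    record Route (a b : A) : Set where
      constructor mkRoute
      field
        {length} : ℕ
        path     : Path graph (from a) (from b) length
        rainbow  : TotalRainbow graph colouring path

    record GeodesicRoute (a b : A) : Set where
      constructor mkGeodesicRoute
      field
        route    : Route a b
        geodesic : IsGeodesic graph (Route.path route)

    open GeodesicRoute public using (route)

    routes⇒rainbow-connected : (∀ a b → Route a b) → TotalRainbowConnected graph colouring
    routes⇒rainbow-connected routes = for-all-names _ λ a b →
      let open Route (routes a b) in length , path , rainbow

    geodesicRoutes⇒strongly-connected : (∀ a b → GeodesicRoute a b)
                                      → StronglyTotalRainbowConnected graph colouring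
    geodesicRoutes⇒strongly-connected routes = for-all-names _ λ a b →
      let open Route (route (routes a b)) in length , path , GeodesicRoute.geodesic (routes a b) , rainbow

    namedColours : ∀ {ℓ} → Vec A (suc ℓ) → Fin ℓ ⊎ Fin (pred ℓ) → Fin k
    namedColours ts (inj₁ i) = eA (lookup ts (inject₁ i)) (lookup ts (suc i))
    namedColours ts (inj₂ j) = vA (lookup ts (inner j))

    colourWord : ∀ {ℓ} → Vec A (suc ℓ) → Vec (Fin k) (ℓ + pred ℓ)
    colourWord {ℓ} ts = tabulate (namedColours ts ∘ splitAt ℓ)

    namedPath-rainbow : ∀ {ℓ} (ts : Vec A (suc ℓ)) (distinct : Unique ts)
                        (adjacent : ∀ i → E (lookup ts (inject₁ i)) (lookup ts (suc i)) ≡ true)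
                      → Unique (colourWord ts) → TotalRainbow graph colouring (namedPath ts distinct adjacent)
    namedPath-rainbow {ℓ} ts distinct adjacent unique =
      pathColours-injective⇒rainbow graph colouring P λ {x} {y} e →
        namedColours-injective (trans (sym (colours-named x)) (trans e (colours-named y)))
      where
        P : Path graph (from (lookup ts zero)) (from (lookup ts (fromℕ ℓ))) ℓ
        P = namedPath ts distinct adjacent
        colours-named : ∀ x → pathColours graph colouring P x ≡ namedColours ts x
        colours-named (inj₁ i) = cong₂ eA (strictlyInverseˡ _) (strictlyInverseˡ _)
        colours-named (inj₂ j) = cong vA (strictlyInverseˡ _)
        word : ∀ x → lookup (colourWord ts) (join ℓ _ x) ≡ namedColours ts x
        word x = trans (lookup∘tabulate _ (join ℓ _ x)) (cong (namedColours ts) (splitAt-join ℓ _ x))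
        namedColours-injective : Injective _≡_ _≡_ (namedColours ts)
        namedColours-injective {x} {y} e = join-injective ℓ _
          (lookup-injective unique _ _ (trans (word x) (trans e (sym (word y)))))

    routeAlong : ∀ {ℓ} (ts : Vec A (suc ℓ)) → Unique ts
               → (∀ i → E (lookup ts (inject₁ i)) (lookup ts (suc i)) ≡ true)
               → Unique (colourWord ts) → Route (lookup ts zero) (lookup ts (fromℕ ℓ))
    routeAlong ts distinct adjacent rainbow =
      mkRoute (namedPath ts distinct adjacent) (namedPath-rainbow ts distinct adjacent rainbow)

    stay : ∀ a → GeodesicRoute a a
    stay a = mkGeodesicRoute (mkRoute P (short-path-rainbow graph colouring z≤n P)) (length0-geodesic graph P)
      where
        P : Path graph (from a) (from a) 0
        P = trivialPath graph (from a)

    hop : ∀ {a b} → a ≢ b → E a b ≡ true → GeodesicRoute a b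
    hop {a} {b} a≢b ab = mkGeodesicRoute (mkRoute P (short-path-rainbow graph colouring ≤-refl P)) (length1-geodesic graph P)
      where
        P : Path graph (from a) (from b) 1
        P = edgePath graph (a≢b ∘ from-injective) (trans (adj-from a b) ab)

    bend : ∀ {a c} b → E a c ≡ false → Unique (a ∷ b ∷ c ∷ []) → E a b ≡ true → E b c ≡ true
         → Unique (eA a b ∷ eA b c ∷ vA b ∷ []) → GeodesicRoute a c
    bend {a} {c} b a≁c distinct ab bc rainbow =
      mkGeodesicRoute (mkRoute P (namedPath-rainbow (a ∷ b ∷ c ∷ []) distinct adjacent rainbow))
                      (nonadjacent-length2-geodesic graph (trans (adj-from a c) a≁c) P)
      where
        adjacent : ∀ i → E (lookup (a ∷ b ∷ c ∷ []) (inject₁ i)) (lookup (a ∷ b ∷ c ∷ []) (suc i)) ≡ true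
        adjacent zero       = ab
        adjacent (suc zero) = bc
        P : Path graph (from a) (from c) 2
        P = namedPath (a ∷ b ∷ c ∷ []) distinct adjacent

Realisable : ℕ → ℕ → Set
Realisable a b = Σ Graph λ G → Connected G × trc≡ G a × strc≡ G b

-- Windmills: k pendant leaves and g triangles at a common centre

module Windmill (k g : ℕ) where

  Rim : Set
  Rim = (Fin k ⊎ Fin g) ⊎ Fin g

  Name : Set
  Name = ⊤ ⊎ Rim

  pattern spoke s = inj₁ s
  pattern leaf i  = inj₁ (inj₁ i)
  pattern tip j   = inj₁ (inj₂ j)
  pattern tip′ j  = inj₂ j
  pattern centre  = inj₁ tt
  pattern rim t   = inj₂ t

  rim-≟ : DecidableEquality Rim
  rim-≟ = ≡-dec (≡-dec _≟_ _≟_) _≟_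

  name-≟ : DecidableEquality Name
  name-≟ = ≡-dec Unit._≟_ rim-≟

  naming : Fin (suc ((k + g) + g)) ↔ Name
  naming = ↔-trans +↔⊎ (1↔⊤ ⊎-↔ ↔-trans +↔⊎ (+↔⊎ ⊎-↔ ↔-refl))

  link : Name → Name → Bool
  link centre              (rim _)         = true
  link (rim (tip i))       (rim (tip′ j))  = does (i ≟ j)
  link _                   _               = false

  adjacent : Name → Name → Bool
  adjacent a b = link a b ∨ link b a

  adjacent-sym : ∀ a b → adjacent a b ≡ adjacent b a
  adjacent-sym a b = ∨-comm (link a b) (link b a)

  adjacent-irr : ∀ a → adjacent a a ≡ false
  adjacent-irr centre          = refl
  adjacent-irr (rim (leaf _))  = refl
  adjacent-irr (rim (tip _))   = refl
  adjacent-irr (rim (tip′ _))  = refl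

  open NamedGraph naming adjacent adjacent-sym adjacent-irr public

  windmill : Graph
  windmill = graph

  rim-centre : ∀ t → adjacent (rim t) centre ≡ true
  rim-centre t = adjacent-sym (rim t) centre

  tips-adjacent : ∀ i j → adjacent (rim (tip i)) (rim (tip′ j)) ≡ does (i ≟ j)
  tips-adjacent i j = ∨-identityʳ (does (i ≟ j))

  rung : ∀ j → adjacent (rim (tip j)) (rim (tip′ j)) ≡ true
  rung j = trans (tips-adjacent j j) (dec-true (j ≟ j) refl)

  rung′ : ∀ j → adjacent (rim (tip′ j)) (rim (tip j)) ≡ true
  rung′ j = dec-true (j ≟ j) refl

  leaf-sole-neighbour : ∀ i t → adjacent (rim (leaf i)) t ≡ true → t ≡ centre
  leaf-sole-neighbour _ centre         _  = refl
  leaf-sole-neighbour _ (rim (leaf _)) ()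
  leaf-sole-neighbour _ (rim (tip _))  ()
  leaf-sole-neighbour _ (rim (tip′ _)) ()

  spokes-nonadjacent : ∀ s s′ → adjacent (rim (spoke s)) (rim (spoke s′)) ≡ false
  spokes-nonadjacent (inj₁ _) (inj₁ _) = refl
  spokes-nonadjacent (inj₁ _) (inj₂ _) = refl
  spokes-nonadjacent (inj₂ _) (inj₁ _) = refl
  spokes-nonadjacent (inj₂ _) (inj₂ _) = refl

  spokes-sole-common-neighbour : ∀ {s s′} → s ≢ s′ → ∀ t
    → adjacent (rim (spoke s)) t ≡ true → adjacent t (rim (spoke s′)) ≡ true → t ≡ centre
  spokes-sole-common-neighbour _ centre _ _ = refl
  spokes-sole-common-neighbour {s} _ (rim (spoke s″)) st _ =
    contradiction (trans (sym (spokes-nonadjacent s s″)) st) λ ()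
  spokes-sole-common-neighbour {inj₁ _} _ (rim (tip′ _)) () _
  spokes-sole-common-neighbour {inj₂ _} {inj₁ _} _ (rim (tip′ _)) _ ()
  spokes-sole-common-neighbour {inj₂ i} {inj₂ i′} s≢s′ (rim (tip′ j)) st ts′ =
    ⊥-elim (s≢s′ (cong inj₂ (trans i≡j (sym (dec-true⁻¹ (i′ ≟ j) ts′)))))
    where
      i≡j : i ≡ j
      i≡j = dec-true⁻¹ (i ≟ j) (trans (sym (tips-adjacent i j)) st)

  throughCentre-distinct : ∀ {t t′ : Rim} → t ≢ t′ → Unique (rim t ∷ centre ∷ rim t′ ∷ [])
  throughCentre-distinct t≢t′ = ((λ ()) ∷ (t≢t′ ∘ inj₂-injective) ∷ []) ∷ ((λ ()) ∷ []) ∷ [] ∷ []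

  throughCentre-adjacent : ∀ t t′ (i : Fin 2)
    → adjacent (lookup (rim t ∷ centre ∷ rim t′ ∷ []) (inject₁ i)) (lookup (rim t ∷ centre ∷ rim t′ ∷ []) (suc i)) ≡ true
  throughCentre-adjacent t _ zero       = rim-centre t
  throughCentre-adjacent _ _ (suc zero) = refl

  throughCentre : ∀ {t t′} → t ≢ t′ → Path windmill (from (rim t)) (from (rim t′)) 2
  throughCentre {t} {t′} t≢t′ = namedPath _ (throughCentre-distinct t≢t′) (throughCentre-adjacent t t′)

  centreEdges : ∀ {K} → (Rim → Fin K) → Fin K → Name → Name → Fin K
  centreEdges ray r centre  centre  = r
  centreEdges ray r centre  (rim t) = ray t
  centreEdges ray r (rim t) centre  = ray t
  centreEdges ray r (rim _) (rim _) = r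

  centreEdges-sym : ∀ {K} (ray : Rim → Fin K) r a b → centreEdges ray r a b ≡ centreEdges ray r b a
  centreEdges-sym ray r centre  centre  = refl
  centreEdges-sym ray r centre  (rim t) = refl
  centreEdges-sym ray r (rim t) centre  = refl
  centreEdges-sym ray r (rim _) (rim _) = refl

  module CentreColouring {K} (ray : Rim → Fin K) (rung-colour : Fin (suc K)) (rimColour : Rim → Fin (suc K)) where

    vertexColour : Name → Fin (suc K)
    vertexColour centre  = zero
    vertexColour (rim t) = rimColour t

    open Coloured vertexColour (centreEdges (suc ∘ ray) rung-colour) (centreEdges-sym _ _) public

    throughCentre-rainbow : ∀ {t t′} → ray t ≢ ray t′ → Unique (suc (ray t) ∷ suc (ray t′) ∷ zero ∷ [])
    throughCentre-rainbow rays = ((rays ∘ suc-injective) ∷ (λ ()) ∷ []) ∷ ((λ ()) ∷ []) ∷ [] ∷ []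

    viaCentre : ∀ {t t′} → t ≢ t′ → ray t ≢ ray t′ → Route (rim t) (rim t′)
    viaCentre {t} {t′} t≢t′ rays =
      routeAlong _ (throughCentre-distinct t≢t′) (throughCentre-adjacent t t′) (throughCentre-rainbow rays)

  -- tip′ j reuses the ray colour of tip j: the two are adjacent, so no geodesic joins them via the centre.
  spokeOf : Rim → Fin k ⊎ Fin g
  spokeOf (spoke s) = s
  spokeOf (tip′ j)  = inj₂ j

  same-spoke : ∀ t t′ → spokeOf t ≡ spokeOf t′ → t ≡ t′ ⊎ adjacent (rim t) (rim t′) ≡ true
  same-spoke (leaf _) (leaf _) refl = inj₁ refl
  same-spoke (tip _)  (tip _)  refl = inj₁ refl
  same-spoke (tip j)  (tip′ _) refl = inj₂ (rung j)
  same-spoke (tip′ j) (tip _)  refl = inj₂ (rung′ j)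
  same-spoke (tip′ _) (tip′ _) refl = inj₁ refl
  same-spoke (leaf _) (tip′ _) ()
  same-spoke (tip′ _) (leaf _) ()

  module Strong = CentreColouring (join k g ∘ spokeOf) zero (λ _ → zero)

  geodesicRoutes : ∀ a b → Strong.GeodesicRoute a b
  geodesicRoutes centre  centre   = Strong.stay centre
  geodesicRoutes centre  (rim t)  = Strong.hop (λ ()) refl
  geodesicRoutes (rim t) centre   = Strong.hop (λ ()) (rim-centre t)
  geodesicRoutes (rim t) (rim t′) with rim-≟ t t′ | adjacent (rim t) (rim t′) in tt′
  ... | yes refl | _     = Strong.stay (rim t)
  ... | no t≢t′  | true  = Strong.hop (t≢t′ ∘ inj₂-injective) tt′
  ... | no t≢t′  | false = Strong.bend centre tt′ (throughCentre-distinct t≢t′) (rim-centre t) refl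
                             (Strong.throughCentre-rainbow {t} {t′} rays-differ)
    where
      rays-differ : join k g (spokeOf t) ≢ join k g (spokeOf t′)
      rays-differ e with same-spoke t t′ (join-injective k g e)
      ... | inj₁ t≡t′ = t≢t′ t≡t′
      ... | inj₂ t~t′ = contradiction (trans (sym tt′) t~t′) λ ()

  strong-colouring : HasSTRC windmill (suc (k + g))
  strong-colouring = Strong.colouring , Strong.geodesicRoutes⇒strongly-connected geodesicRoutes

  strc-lower-bound : 2 ≤ k + g → ∀ {m} → HasSTRC windmill m → suc (k + g) ≤ m
  strc-lower-bound 2≤k+g (c , strong) = wedges-star-bound windmill c (vertex ∘ splitAt k) 2≤k+g wedge
    where
      vertex : Fin k ⊎ Fin g → V windmill
      vertex s = from (rim (spoke s))
      wedge : ∀ x y → x ≢ y → RainbowWedge windmill c (vertex (splitAt k x)) (from centre) (vertex (splitAt k y))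
      wedge x y x≢y =
        let _ , P , geodesic , rainbow = strong (vertex (splitAt k x)) (vertex (splitAt k y))
        in geodesic-wedge windmill c
             (trans (adj-from (rim (spoke (splitAt k x))) _) (spokes-nonadjacent (splitAt k x) (splitAt k y)))
             (throughCentre (x≢y ∘ splitAt-injective k ∘ inj₁-injective))
             (sole-common-neighbour {rim (spoke (splitAt k x))} {c = rim (spoke (splitAt k y))}
               (spokes-sole-common-neighbour (x≢y ∘ splitAt-injective k)))
             P geodesic rainbow

  trc-lower-bound : 2 ≤ k → ∀ {m} → HasTRC windmill m → suc k ≤ m
  trc-lower-bound 2≤k (c , connected) = wedges-star-bound windmill c (λ i → from (rim (leaf i))) 2≤k wedge
    where
      wedge : ∀ i j → i ≢ j → RainbowWedge windmill c (from (rim (leaf i))) (from centre) (from (rim (leaf j)))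
      wedge i j i≢j =
        let _ , P , rainbow = connected (from (rim (leaf i))) (from (rim (leaf j)))
        in pendants-wedge windmill c (λ e → i≢j (leaf-injective (from-injective e)))
             (sole-neighbour {rim (leaf i)} (leaf-sole-neighbour i))
             (sole-neighbour {rim (leaf j)} (leaf-sole-neighbour j)) P rainbow
        where
          leaf-injective : ∀ {i j : Fin k} → rim (leaf i) ≡ rim (leaf j) → i ≡ j
          leaf-injective refl = refl

  realises : 2 ≤ k → HasTRC windmill (suc k) → Realisable (suc k) (suc (k + g))
  realises 2≤k rainbow-colouring =
      windmill
    , strongly⇒connected windmill strong-colouring
    , (rainbow-colouring , λ _ m<1+k c → ≤⇒≯ (trc-lower-bound 2≤k c) m<1+k)
    , (strong-colouring , λ _ m<1+k+g c → ≤⇒≯ (strc-lower-bound (≤-trans 2≤k (m≤m+n k g)) c) m<1+k+g)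

module RainbowWindmill (k′ g : ℕ) where
  open Windmill (4 + k′) g

  -- Centre edges get colour 1 + i (leaf i), 1 (tip) and 2 (tip′), rungs 3, tips 4, everything else 0.
  -- Where the two centre edges of a pair clash (leaf 0 and a tip, leaf 1 and a tip′, two tips on the
  -- same side) the route detours through the partner tip.
  ray : Rim → Fin (4 + k′)
  ray (leaf i) = i
  ray (tip _)  = 0F
  ray (tip′ _) = 1F

  rimColour : Rim → Fin (5 + k′)
  rimColour (leaf _) = 0F
  rimColour (tip _)  = 4F
  rimColour (tip′ _) = 4F

  open CentreColouring ray 3F rimColour

  routes : ∀ a b → Route a b
  routes centre centre = route (stay centre)
  routes centre (rim t) = route (hop (λ ()) refl)
  routes (rim t) centre = route (hop (λ ()) (rim-centre t))
  routes (rim (leaf i)) (rim (leaf i′)) with i ≟ i′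
  ... | yes refl = route (stay (rim (leaf i)))
  ... | no  i≢i′ = viaCentre (λ { refl → i≢i′ refl }) i≢i′
  routes (rim (leaf 0F)) (rim (tip j)) =
    routeAlong (rim (leaf 0F) ∷ centre ∷ rim (tip′ j) ∷ rim (tip j) ∷ []) (unique-by-decision name-≟)
      (λ { 0F → refl ; 1F → refl ; 2F → rung′ j }) (unique-by-decision _≟_)
  routes (rim (leaf (suc i))) (rim (tip j)) = viaCentre (λ ()) (λ ())
  routes (rim (leaf 0F)) (rim (tip′ j)) = viaCentre (λ ()) (λ ())
  routes (rim (leaf 1F)) (rim (tip′ j)) =
    routeAlong (rim (leaf 1F) ∷ centre ∷ rim (tip j) ∷ rim (tip′ j) ∷ []) (unique-by-decision name-≟)
      (λ { 0F → refl ; 1F → refl ; 2F → rung j }) (unique-by-decision _≟_)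
  routes (rim (leaf (suc (suc i)))) (rim (tip′ j)) = viaCentre (λ ()) (λ ())
  routes (rim (tip j)) (rim (leaf 0F)) =
    routeAlong (rim (tip j) ∷ rim (tip′ j) ∷ centre ∷ rim (leaf 0F) ∷ []) (unique-by-decision name-≟)
      (λ { 0F → rung j ; 1F → rim-centre (tip′ j) ; 2F → refl }) (unique-by-decision _≟_)
  routes (rim (tip j)) (rim (leaf (suc i))) = viaCentre (λ ()) (λ ())
  routes (rim (tip′ j)) (rim (leaf 0F)) = viaCentre (λ ()) (λ ())
  routes (rim (tip′ j)) (rim (leaf 1F)) =
    routeAlong (rim (tip′ j) ∷ rim (tip j) ∷ centre ∷ rim (leaf 1F) ∷ []) (unique-by-decision name-≟)
      (λ { 0F → rung′ j ; 1F → rim-centre (tip j) ; 2F → refl }) (unique-by-decision _≟_)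
  routes (rim (tip′ j)) (rim (leaf (suc (suc i)))) = viaCentre (λ ()) (λ ())
  routes (rim (tip j)) (rim (tip j′)) with j ≟ j′
  ... | yes refl = route (stay (rim (tip j)))
  ... | no  j≢j′ =
    routeAlong (rim (tip j) ∷ rim (tip′ j) ∷ centre ∷ rim (tip j′) ∷ [])
      (((λ ()) ∷ (λ ()) ∷ (λ { refl → j≢j′ refl }) ∷ []) ∷ ((λ ()) ∷ (λ ()) ∷ []) ∷ ((λ ()) ∷ []) ∷ [] ∷ [])
      (λ { 0F → rung j ; 1F → rim-centre (tip′ j) ; 2F → refl }) (unique-by-decision _≟_)
  routes (rim (tip′ j)) (rim (tip′ j′)) with j ≟ j′
  ... | yes refl = route (stay (rim (tip′ j)))
  ... | no  j≢j′ =
    routeAlong (rim (tip′ j) ∷ rim (tip j) ∷ centre ∷ rim (tip′ j′) ∷ [])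
      (((λ ()) ∷ (λ ()) ∷ (λ { refl → j≢j′ refl }) ∷ []) ∷ ((λ ()) ∷ (λ ()) ∷ []) ∷ ((λ ()) ∷ []) ∷ [] ∷ [])
      (λ { 0F → rung′ j ; 1F → rim-centre (tip j) ; 2F → refl }) (unique-by-decision _≟_)
  routes (rim (tip j)) (rim (tip′ j′)) with j ≟ j′
  ... | yes refl = route (hop (λ ()) (rung j))
  ... | no  j≢j′ = viaCentre (λ ()) (λ ())
  routes (rim (tip′ j)) (rim (tip j′)) with j ≟ j′
  ... | yes refl = route (hop (λ ()) (rung′ j))
  ... | no  j≢j′ = viaCentre (λ ()) (λ ())

  rainbow-colouring : HasTRC windmill (5 + k′)
  rainbow-colouring = colouring , routes⇒rainbow-connected routes

single-vertex : Realisable 1 1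
single-vertex =
    windmill
  , strongly⇒connected windmill strong-colouring
  , (strongly⇒rainbow windmill strong-colouring , λ m m<1 → colourless m m<1 ∘ proj₁)
  , (strong-colouring , λ m m<1 → colourless m m<1 ∘ proj₁)
  where
    open Windmill 0 0
    colourless : ∀ m → m < 1 → ¬ TotalColouring windmill m
    colourless zero    _         = no-colouring-without-colours windmill (from centre)
    colourless (suc _) (s≤s ())

Admissible : ℕ → ℕ → Set
Admissible a b = (a ≡ b × (a ≡ 1 ⊎ a ≡ 3 ⊎ a ≡ 4)) ⊎ (5 ≤ a × a ≤ b)

admissible : ∀ {a b} → 1 ≤ a → a ≤ b → (a ≤ 4 → a ≡ b) → a ≢ 2 → Admissible a b
admissible {1} _ _ small _ = inj₁ (small (s≤s z≤n) , inj₁ refl)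
admissible {2} _ _ _ a≢2 = ⊥-elim (a≢2 refl)
admissible {3} _ _ small _ = inj₁ (small (s≤s (s≤s (s≤s z≤n))) , inj₂ (inj₁ refl))
admissible {4} _ _ small _ = inj₁ (small (s≤s (s≤s (s≤s (s≤s z≤n)))) , inj₂ (inj₂ refl))
admissible {suc (suc (suc (suc (suc _))))} _ a≤b _ _ = inj₂ (s≤s (s≤s (s≤s (s≤s (s≤s z≤n)))) , a≤b)

realisable⇒admissible : ∀ {a b} → 1 ≤ a → Realisable a b → Admissible a b
realisable⇒admissible {a} {b} 1≤a (G , _ , (trc , fewer-trc) , (strc , fewer-strc)) =
  admissible 1≤a a≤b small a≢2
  where
    a≤b : a ≤ b
    a≤b = ≮⇒≥ λ b<a → fewer-trc b b<a (strongly⇒rainbow G strc)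
    small : a ≤ 4 → a ≡ b
    small a≤4 = ≤-antisym a≤b (≮⇒≥ λ a<b → fewer-strc a a<b
      (proj₁ trc , few-colours-rainbow⇒strongly G (proj₁ trc) a≤4 (proj₂ trc)))
    a≢2 : a ≢ 2
    a≢2 refl = fewer-trc 1 ≤-refl (two-colours⇒one G trc)

admissible⇒realisable : ∀ {a b} → Admissible a b → Realisable a b
admissible⇒realisable (inj₁ (refl , inj₁ refl)) = single-vertex
admissible⇒realisable (inj₁ (refl , inj₂ (inj₁ refl))) =
  Windmill.realises 2 0 ≤-refl (strongly⇒rainbow _ (Windmill.strong-colouring 2 0))
admissible⇒realisable (inj₁ (refl , inj₂ (inj₂ refl))) =
  Windmill.realises 3 0 (s≤s (s≤s z≤n)) (strongly⇒rainbow _ (Windmill.strong-colouring 3 0))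
admissible⇒realisable (inj₂ (s≤s (s≤s (s≤s (s≤s (s≤s {n = k′} _)))) , a≤b)) with m≤n⇒∃[o]m+o≡n a≤b
... | g , refl = Windmill.realises (4 + k′) g (s≤s (s≤s z≤n)) (RainbowWindmill.rainbow-colouring k′ g)

theorem4p7 : ∀ (a b : ℕ) → 1 ≤ a → 1 ≤ b →
    (Σ Graph (λ G → Connected G × trc≡ G a × strc≡ G b))
      ⇔ ((a ≡ b × (a ≡ 1 ⊎ a ≡ 3 ⊎ a ≡ 4)) ⊎ (5 ≤ a × a ≤ b))
theorem4p7 a b 1≤a _ = mk⇔ (realisable⇒admissible 1≤a) admissible⇒realisable
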